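{- Let $n=p_1^{a_1}\cdots p_r^{a_r}>1$ be the prime factorization of $n$. If all exponents $a_i$ ($i=1,\dots,r$) are even and $n$ is bi-unitary harmonic, then $\omega(n)\ge 2$.
   Context: $\omega(n)$ is the number of distinct prime factors of $n$. A divisor $d$ of $n$ is a unitary divisor if $\gcd(d,n/d)=1$; a divisor $d$ of $n$ is a bi-unitary divisor if the greatest common unitary divisor of $d$ and $n/d$ is $1$. $\sigma^{**}(n)$ denotes the sum and $d^{**}(n)$ the number of bi-unitary divisors of $n$. $n$ is bi-unitary harmonic if $\sigma^{**}(n)\mid n\,d^{**}(n)$. -}

module Defs where

open import Data.Nat using (ℕ; zero; suc; _*_; _^_; _⊔_; _≟_)
open import Data.Nat.DivMod using (_/_)
open import Data.Nat.Divisibility using (_∣_; _∣?_)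
open import Data.Nat.GCD using (gcd)
open import Data.Nat.Primality using (Prime; prime?)
open import Data.Nat.ListAction using (sum)
open import Data.List using (List; filter; length; foldr; map; upTo)
open import Data.Product using (_×_; ∃)
open import Relation.Nullary using (¬_)
open import Relation.Nullary.Decidable using (_×-dec_)
open import Relation.Binary.PropositionalEquality using (_≡_)

-- quotient n / d (only used for divisors d ≥ 1; convention n ÷ 0 = 0)
_÷_ : ℕ → ℕ → ℕ
n ÷ zero = zero
n ÷ suc d = n / suc d

1‥ : ℕ → List ℕ
1‥ n = map suc (upTo n)

IsUnitaryDivisor : ℕ → ℕ → Set
IsUnitaryDivisor d n = d ∣ n × gcd d (n ÷ d) ≡ 1

unitary? : (d n : ℕ) → _
unitary? d n = (d ∣? n) ×-dec (gcd d (n ÷ d) ≟ 1)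

-- common unitary divisors of a and b (all lie in 1..a when a ≥ 1)
commonUnitaryDivisors : ℕ → ℕ → List ℕ
commonUnitaryDivisors a b = filter (λ k → unitary? k a ×-dec unitary? k b) (1‥ a)

gcud : ℕ → ℕ → ℕ
gcud a b = foldr _⊔_ 0 (commonUnitaryDivisors a b)

IsBiUnitaryDivisor : ℕ → ℕ → Set
IsBiUnitaryDivisor d n = d ∣ n × gcud d (n ÷ d) ≡ 1

biUnitary? : (d n : ℕ) → _
biUnitary? d n = (d ∣? n) ×-dec (gcud d (n ÷ d) ≟ 1)

biUnitaryDivisors : ℕ → List ℕ
biUnitaryDivisors n = filter (λ d → biUnitary? d n) (1‥ n)

σ** : ℕ → ℕ
σ** n = sum (biUnitaryDivisors n)

d** : ℕ → ℕ
d** n = length (biUnitaryDivisors n)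

BiUnitaryHarmonic : ℕ → Set
BiUnitaryHarmonic n = σ** n ∣ n * d** n

ω : ℕ → ℕ
ω n = length (filter (λ p → prime? p ×-dec (p ∣? n)) (1‥ n))

ExactPower : ℕ → ℕ → ℕ → Set
ExactPower p a n = p ^ a ∣ n × ¬ (p ^ suc a ∣ n)

AllExponentsEven : ℕ → Set
AllExponentsEven n = ∀ p a → Prime p → ExactPower p a n → ∃ λ k → a ≡ 2 * k

module Submission where

-- A number n > 1 with ω(n) ≤ 1 is a prime power p^a, and no prime power
-- p^a with a ≥ 1 is bi-unitary harmonic, whatever the parity of a.
--
-- Why a prime power n is not bi-unitary harmonic: 1 and n are bi-unitary
-- divisors of n, and every other divisor d > 1 of n is a multiple of p.
-- Writing R for the list of bi-unitary divisors other than 1, we get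
--   σ**(n) = 1 + ΣR   and   d**(n) = 1 + |R|   with p ∣ ΣR.
-- So σ**(n) ≡ 1 (mod p) is coprime to n, and σ**(n) ∣ n·d**(n) forces
-- σ**(n) ∣ d**(n).  But every element of R is ≥ 2 and n ∈ R, so
-- ΣR ≥ 2|R| > |R|, i.e. σ**(n) > d**(n) > 0: a contradiction.

open import Defs
open import Data.Nat using (ℕ; _<_; _≤_)
open import Data.Nat.Base using (zero; suc; _+_; _*_; _⊔_; z≤n; s≤s; z<s; NonZero; >-nonZero; >-nonZero⁻¹)
open import Data.Nat.Properties
open import Data.Nat.Divisibility
open import Data.Nat.DivMod using (n/n≡1)
open import Data.Nat.GCD using (gcd; gcd-greatest; gcd[m,n]∣m; gcd[m,n]∣n)
open import Data.Nat.Coprimality using (Coprime; coprime-divisor)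
open import Data.Nat.Primality using (Prime; prime?; prime⇒nonZero; ¬prime[1])
open import Data.Nat.Primality.Factorisation using (factorise)
open import Data.Nat.ListAction using (sum)
open import Data.Nat.ListAction.Properties using (∈⇒∣product)
open import Data.List using (List; []; _∷_; filter; length; foldr; map; applyUpTo)
open import Data.List.Properties using (filter-accept)
open import Data.List.Membership.Propositional using (_∈_)
open import Data.List.Membership.Propositional.Properties
  using (∈-map⁺; ∈-map⁻; ∈-filter⁺; ∈-upTo⁺; ∈-applyUpTo⁺; ∈-applyUpTo⁻)
open import Data.List.Relation.Unary.All as All using (All; []; _∷_)
open import Data.List.Relation.Unary.All.Properties using (all-filter; filter⁺)
open import Data.List.Relation.Unary.Any using (here; there)
open import Data.Product using (Σ; _×_; _,_; proj₁)
open import Data.Empty using (⊥-elim)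
open import Relation.Nullary using (¬_; yes; no)
open import Relation.Nullary.Negation using (contradiction)
open import Relation.Nullary.Decidable using (_×-dec_)
open import Relation.Binary.PropositionalEquality

distinct∈⇒2≤length : ∀ {x y : ℕ} {xs} → x ∈ xs → y ∈ xs → x ≢ y → 2 ≤ length xs
distinct∈⇒2≤length (here refl) (here refl) x≢y = contradiction refl x≢y
distinct∈⇒2≤length {xs = _ ∷ _ ∷ _} (here _) (there _) _ = s≤s (s≤s z≤n)
distinct∈⇒2≤length {xs = _ ∷ _ ∷ _} (there _) (here _) _ = s≤s (s≤s z≤n)
distinct∈⇒2≤length (there x∈) (there y∈) x≢y =
  m≤n⇒m≤1+n (distinct∈⇒2≤length x∈ y∈ x≢y)

foldr-⊔-lub : ∀ {m} xs → All (_≤ m) xs → foldr _⊔_ 0 xs ≤ m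
foldr-⊔-lub [] [] = z≤n
foldr-⊔-lub (x ∷ xs) (x≤m ∷ xs≤m) = ⊔-lub x≤m (foldr-⊔-lub xs xs≤m)

∈⇒≤foldr-⊔ : ∀ {x} xs → x ∈ xs → x ≤ foldr _⊔_ 0 xs
∈⇒≤foldr-⊔ (y ∷ ys) (here refl) = m≤m⊔n y _
∈⇒≤foldr-⊔ (y ∷ ys) (there x∈) = ≤-trans (∈⇒≤foldr-⊔ ys x∈) (m≤n⊔m y _)

∣-sum : ∀ {d} xs → All (d ∣_) xs → d ∣ sum xs
∣-sum [] [] = _ ∣0
∣-sum (x ∷ xs) (d∣x ∷ d∣xs) = ∣m∣n⇒∣m+n d∣x (∣-sum xs d∣xs)

2*length≤sum : ∀ xs → All (2 ≤_) xs → 2 * length xs ≤ sum xs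
2*length≤sum [] [] = z≤n
2*length≤sum (x ∷ xs) (2≤x ∷ 2≤xs) = begin
  2 * suc (length xs)   ≡⟨ *-suc 2 (length xs) ⟩
  2 + 2 * length xs     ≤⟨ +-mono-≤ 2≤x (2*length≤sum xs 2≤xs) ⟩
  x + sum xs            ∎
  where open ≤-Reasoning

length<sum : ∀ {x} xs → x ∈ xs → All (2 ≤_) xs → length xs < sum xs
length<sum xs@(_ ∷ _) _ 2≤xs = begin-strict
  length xs                 <⟨ m<m+n (length xs) z<s ⟩
  length xs + length xs     ≡⟨ cong (length xs +_) (sym (+-identityʳ (length xs))) ⟩
  2 * length xs             ≤⟨ 2*length≤sum xs 2≤xs ⟩
  sum xs                    ∎
  where open ≤-Reasoning

∈-1‥ : ∀ {k n} → 0 < k → k ≤ n → k ∈ 1‥ n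
∈-1‥ {suc k} _ k<n = ∈-map⁺ suc (∈-upTo⁺ k<n)

-- The tail 2‥(m+1) of 1‥(m+1), whose elements are all at least 2.
2‥ : ℕ → List ℕ
2‥ m = map suc (applyUpTo suc m)

2≤-2‥ : ∀ m → All (2 ≤_) (2‥ m)
2≤-2‥ m = All.tabulate elements≥2
  where
  elements≥2 : ∀ {x} → x ∈ 2‥ m → 2 ≤ x
  elements≥2 x∈ with _ , y∈ , refl ← ∈-map⁻ suc x∈
                with _ , _ , refl ← ∈-applyUpTo⁻ suc y∈ = s≤s (s≤s z≤n)

primeDivisor : ∀ d → 1 < d → Σ ℕ λ q → Prime q × q ∣ d
primeDivisor d@(suc _) 1<d with factorise d
... | record { factors = [] ; isFactorisation = d≡1 } = contradiction (sym d≡1) (<⇒≢ 1<d)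
... | record { factors = q ∷ qs ; isFactorisation = d≡∏ ; factorsPrime = q-prime ∷ _ } =
  q , q-prime , subst (q ∣_) (sym d≡∏) (∈⇒∣product {ns = q ∷ qs} (here refl))

-- p is the only prime dividing n, i.e. n is a power of p.
OnlyPrimeFactor : ℕ → ℕ → Set
OnlyPrimeFactor p n = ∀ {q} → Prime q → q ∣ n → q ≡ p

prime∣⇒∈ω-list : ∀ {n q} → .{{NonZero n}} → Prime q → q ∣ n →
                 q ∈ filter (λ p → prime? p ×-dec (p ∣? n)) (1‥ n)
prime∣⇒∈ω-list {n} q-prime q∣n =
  ∈-filter⁺ (λ p → prime? p ×-dec (p ∣? n))
    (∈-1‥ (>-nonZero⁻¹ _ {{prime⇒nonZero q-prime}}) (∣⇒≤ q∣n)) (q-prime , q∣n)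

ω<2⇒onlyPrimeFactor : ∀ {n p} → .{{NonZero n}} → ¬ 2 ≤ ω n →
                      Prime p → p ∣ n → OnlyPrimeFactor p n
ω<2⇒onlyPrimeFactor {p = p} ω≱2 p-prime p∣n {q} q-prime q∣n with q ≟ p
... | yes q≡p = q≡p
... | no q≢p = contradiction
  (distinct∈⇒2≤length (prime∣⇒∈ω-list q-prime q∣n) (prime∣⇒∈ω-list p-prime p∣n) q≢p) ω≱2

primePower-divisor : ∀ {p n d} → OnlyPrimeFactor p n → 1 < d → d ∣ n → p ∣ d
primePower-divisor only 1<d d∣n with q , q-prime , q∣d ← primeDivisor _ 1<d =
  subst (_∣ _) (only q-prime (∣-trans q∣d d∣n)) q∣d

primePower-coprime : ∀ {p n m} → Prime p → OnlyPrimeFactor p n → p ∣ m → Coprime (suc m) n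
primePower-coprime _ _ _ {zero} (0∣1+m , _) = contradiction (0∣⇒≡0 0∣1+m) λ ()
primePower-coprime _ _ _ {suc zero} _ = refl
primePower-coprime {p} {m = m} p-prime only p∣m {suc (suc _)} (d∣1+m , d∣n) =
  ⊥-elim (¬prime[1] (subst Prime (∣1⇒≡1 p∣1) p-prime))
  where
  p∣1+m : p ∣ suc m
  p∣1+m = ∣-trans (primePower-divisor only (s≤s (s≤s z≤n)) d∣n) d∣1+m
  p∣1 : p ∣ 1
  p∣1 = ∣m+n∣m⇒∣n (subst (p ∣_) (+-comm 1 m) p∣1+m) p∣m

1-unitary : ∀ a → IsUnitaryDivisor 1 a
1-unitary a = 1∣ a , ∣1⇒≡1 (gcd[m,n]∣m 1 (a ÷ 1))

-- Coprime numbers have greatest common unitary divisor 1: 1 is a common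
-- unitary divisor, and every common unitary divisor divides gcd a b = 1.
coprime⇒gcud≡1 : ∀ a b → .{{NonZero a}} → gcd a b ≡ 1 → gcud a b ≡ 1
coprime⇒gcud≡1 a b gcd≡1 = ≤-antisym
  (foldr-⊔-lub (commonUnitaryDivisors a b) (All.map common≤1 (all-filter common? (1‥ a))))
  (∈⇒≤foldr-⊔ (commonUnitaryDivisors a b)
    (∈-filter⁺ common? (∈-1‥ z<s (>-nonZero⁻¹ a)) (1-unitary a , 1-unitary b)))
  where
  common? = λ k → unitary? k a ×-dec unitary? k b
  common≤1 : ∀ {k} → IsUnitaryDivisor k a × IsUnitaryDivisor k b → k ≤ 1
  common≤1 ((k∣a , _) , (k∣b , _)) = ≤-reflexive (∣1⇒≡1 (subst (_ ∣_) gcd≡1 (gcd-greatest k∣a k∣b)))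

-- 1 and n are bi-unitary divisors of n ≥ 1 (their cofactors n and 1 are coprime to them).
1-biUnitary : ∀ n → IsBiUnitaryDivisor 1 n
1-biUnitary n = 1∣ n , coprime⇒gcud≡1 1 (n ÷ 1) (∣1⇒≡1 (gcd[m,n]∣m 1 (n ÷ 1)))

n-biUnitary : ∀ n → .{{NonZero n}} → IsBiUnitaryDivisor n n
n-biUnitary n@(suc _) = ∣-refl ,
  subst (λ c → gcud n c ≡ 1) (sym (n/n≡1 n)) (coprime⇒gcud≡1 n 1 (∣1⇒≡1 (gcd[m,n]∣n n 1)))

nontrivialBiUnitaryDivisors : ℕ → List ℕ
nontrivialBiUnitaryDivisors m = filter (λ d → biUnitary? d (suc m)) (2‥ m)

biUnitaryDivisors-split : ∀ m → biUnitaryDivisors (suc m) ≡ 1 ∷ nontrivialBiUnitaryDivisors m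
biUnitaryDivisors-split m = filter-accept (λ d → biUnitary? d (suc m)) (1-biUnitary (suc m))

nontrivial-≥2 : ∀ m → All (2 ≤_) (nontrivialBiUnitaryDivisors m)
nontrivial-≥2 m = filter⁺ (λ d → biUnitary? d (suc m)) (2≤-2‥ m)

nontrivial-∣ : ∀ m → All (_∣ suc m) (nontrivialBiUnitaryDivisors m)
nontrivial-∣ m = All.map proj₁ (all-filter (λ d → biUnitary? d (suc m)) (2‥ m))

n∈nontrivial : ∀ m → 1 ≤ m → suc m ∈ nontrivialBiUnitaryDivisors m
n∈nontrivial m@(suc k) _ =
  ∈-filter⁺ (λ d → biUnitary? d (suc m)) (∈-map⁺ suc (∈-applyUpTo⁺ suc (n<1+n k))) (n-biUnitary (suc m))

primePower-notHarmonic : ∀ {p} n → 1 < n → Prime p → OnlyPrimeFactor p n → ¬ BiUnitaryHarmonic n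
primePower-notHarmonic {p} n@(suc m) (s≤s 1≤m) p-prime only harmonic =
  <⇒≱ count<sum (∣⇒≤ σ∣d)
  where
  R : List ℕ
  R = nontrivialBiUnitaryDivisors m
  harmonic′ : suc (sum R) ∣ n * suc (length R)
  harmonic′ = subst (λ ds → sum ds ∣ n * length ds) (biUnitaryDivisors-split m) harmonic
  p∣sumR : p ∣ sum R
  p∣sumR = ∣-sum R (All.zipWith (λ (2≤d , d∣n) → primePower-divisor only 2≤d d∣n)
                                (nontrivial-≥2 m , nontrivial-∣ m))
  σ∣d : suc (sum R) ∣ suc (length R)
  σ∣d = coprime-divisor (primePower-coprime p-prime only p∣sumR) harmonic′
  count<sum : suc (length R) < suc (sum R)
  count<sum = s≤s (length<sum R (n∈nontrivial m 1≤m) (nontrivial-≥2 m))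

theorem3 : (n : ℕ) → 1 < n → AllExponentsEven n → BiUnitaryHarmonic n → 2 ≤ ω n
theorem3 n 1<n _ harmonic with 2 ≤? ω n
... | yes 2≤ω = 2≤ω
... | no ω≱2 with p , p-prime , p∣n ← primeDivisor n 1<n =
  ⊥-elim (primePower-notHarmonic n 1<n p-prime
           (ω<2⇒onlyPrimeFactor {{nonZero}} ω≱2 p-prime p∣n) harmonic)
  where
  nonZero : NonZero n
  nonZero = >-nonZero (<-trans z<s 1<n)
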